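{- Let $w$ be a maximal consistent infinite sequent. (i) If $(A\to B)\in w_s$, then there exists a maximal consistent infinite sequent $w'>w$ with $A\in w'_a$ and $B\in w'_s$. (ii) If $\forall xA(x)\in w_s$, then there exists a maximal consistent infinite sequent $w'>w$ with $A(a)\in w'_s$ for some variable $a$ with $a\in D(w')$.
   Context: Language: first-order language with predicate symbols, variables, constants (no other function symbols), $\&,\vee,\to,\bot,\forall,\exists$, and terms $\epsilon xA(x)$ for every formula $A(x)$. $t\downarrow$ is $\top$ for a variable or constant $t$, and $\exists y(\exists xA(x)\to A(y))$ for $t=\epsilon xA(x)$. IPC$\epsilon$: sequent calculus with axioms $\Gamma,A\Rightarrow A$, $\Gamma,\bot\Rightarrow A$, usual intuitionistic rules for $\&,\vee,\to$, $\Rightarrow\forall$ with eigenvariable condition, cut, and: from $\Gamma\Rightarrow t\downarrow$ and $F(t),\Delta\Rightarrow G$ infer $\forall zF(z),\Gamma,\Delta\Rightarrow G$; from $\Gamma\Rightarrow t\downarrow$ and $\Gamma\Rightarrow F(t)$ infer $\Gamma\Rightarrow\exists zF(z)$; from $A(\epsilon xA(x)),\Gamma\Rightarrow G$ infer $\exists xA(x),\Gamma\Rightarrow G$. An infinite sequent $w$ is a pair of sets of formulas $\Gamma\Rightarrow\Delta$ ($w_a:=\Gamma$, $w_s:=\Delta$) such that infinitely many variables do not occur in $\Gamma\cup\Delta$. $L_w$: all terms and formulas whose free variables and constants occur in formulas of $w$. $D(w)$: the set of terms $t\in L_w$ with $(t\downarrow)\in w_a$ (i.e. all free variables and constants of $w$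 plus all $\epsilon xA(x)$ with $\exists y(\exists xA(x)\to A(y))\in w_a$). $w$ is consistent if no $\Gamma\Rightarrow D_1\vee\dots\vee D_n$ with finite $\Gamma\subseteq w_a$, $\{D_1,\dots,D_n\}\subseteq w_s$ is derivable in IPC$\epsilon$ (empty disjunction $=\bot$); maximal consistent if moreover $w_a\cup w_s$ contains every formula of $L_w$. For infinite sequents, $w<w'$ iff $w_a\subseteq w'_a$ and $D(w)\subseteq D(w')$. -}

module Defs where

open import Level using (0ℓ)
open import Data.Nat using (ℕ; zero; suc; _≤_)
open import Data.Fin using (Fin; zero; suc)
open import Data.List using (List; []; _∷_; _++_; concatMap)
open import Data.List.Membership.Propositional using (_∈_; _∉_)
open import Data.List.Relation.Binary.Subset.Propositional using (_⊆_)
open import Data.List.Relation.Unary.All using (All)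
open import Data.Product using (Σ; ∃; ∃-syntax; _×_; _,_)
open import Data.Sum using (_⊎_)
open import Relation.Nullary using (¬_)

-- Syntax: well-scoped de Bruijn representation of bound variables.
-- Term n / Formula n have n bound variables in scope (index 0 = innermost
-- binder).
-- Predicate symbols are named by natural numbers and applied to a list of
-- terms (so (P, k) with k = length of the list plays the role of a k-ary
-- predicate symbol).

mutual
  data Term (n : ℕ) : Set where
    bvar : Fin n → Term n
    fvar : ℕ → Term n
    con  : ℕ → Term n
    eps  : Formula (suc n) → Term n

  data Formula (n : ℕ) : Set where
    atom : ℕ → List (Term n) → Formula n
    ⊥'   : Formula n
    _&_  : Formula n → Formula n → Formula n
    _∨'_ : Formula n → Formula n → Formula n
    _⇒_  : Formula n → Formula n → Formula n
    all  : Formula (suc n) → Formula n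
    ex   : Formula (suc n) → Formula n

infixr 6 _&_
infixr 5 _∨'_
infixr 4 _⇒_

-- (closed w.r.t. bound variables) terms and formulas
Tm : Set
Tm = Term 0

Fm : Set
Fm = Formula 0

liftR : ∀ {m k} → (Fin m → Fin k) → Fin (suc m) → Fin (suc k)
liftR ρ zero    = zero
liftR ρ (suc i) = suc (ρ i)

mutual
  renT : ∀ {m k} → (Fin m → Fin k) → Term m → Term k
  renT ρ (bvar i) = bvar (ρ i)
  renT ρ (fvar a) = fvar a
  renT ρ (con c)  = con c
  renT ρ (eps A)  = eps (renF (liftR ρ) A)

  renTs : ∀ {m k} → (Fin m → Fin k) → List (Term m) → List (Term k)
  renTs ρ []       = []
  renTs ρ (t ∷ ts) = renT ρ t ∷ renTs ρ ts

  renF : ∀ {m k} → (Fin m → Fin k) → Formula m → Formula k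
  renF ρ (atom P ts) = atom P (renTs ρ ts)
  renF ρ ⊥'          = ⊥'
  renF ρ (A & B)     = renF ρ A & renF ρ B
  renF ρ (A ∨' B)    = renF ρ A ∨' renF ρ B
  renF ρ (A ⇒ B)     = renF ρ A ⇒ renF ρ B
  renF ρ (all A)     = all (renF (liftR ρ) A)
  renF ρ (ex A)      = ex (renF (liftR ρ) A)

liftS : ∀ {m k} → (Fin m → Term k) → Fin (suc m) → Term (suc k)
liftS σ zero    = bvar zero
liftS σ (suc i) = renT suc (σ i)

mutual
  subT : ∀ {m k} → (Fin m → Term k) → Term m → Term k
  subT σ (bvar i) = σ i
  subT σ (fvar a) = fvar a
  subT σ (con c)  = con c
  subT σ (eps A)  = eps (subF (liftS σ) A)

  subTs : ∀ {m k} → (Fin m → Term k) → List (Term m) → List (Term k)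
  subTs σ []       = []
  subTs σ (t ∷ ts) = subT σ t ∷ subTs σ ts

  subF : ∀ {m k} → (Fin m → Term k) → Formula m → Formula k
  subF σ (atom P ts) = atom P (subTs σ ts)
  subF σ ⊥'          = ⊥'
  subF σ (A & B)     = subF σ A & subF σ B
  subF σ (A ∨' B)    = subF σ A ∨' subF σ B
  subF σ (A ⇒ B)     = subF σ A ⇒ subF σ B
  subF σ (all A)     = all (subF (liftS σ) A)
  subF σ (ex A)      = ex (subF (liftS σ) A)

inst : Formula 1 → Tm → Fm
inst A t = subF (λ _ → t) A

mutual
  fvT : ∀ {n} → Term n → List ℕ
  fvT (bvar i) = []
  fvT (fvar a) = a ∷ []
  fvT (con c)  = []
  fvT (eps A)  = fvF A

  fvTs : ∀ {n} → List (Term n) → List ℕ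
  fvTs []       = []
  fvTs (t ∷ ts) = fvT t ++ fvTs ts

  fvF : ∀ {n} → Formula n → List ℕ
  fvF (atom P ts) = fvTs ts
  fvF ⊥'          = []
  fvF (A & B)     = fvF A ++ fvF B
  fvF (A ∨' B)    = fvF A ++ fvF B
  fvF (A ⇒ B)     = fvF A ++ fvF B
  fvF (all A)     = fvF A
  fvF (ex A)      = fvF A

mutual
  cT : ∀ {n} → Term n → List ℕ
  cT (bvar i) = []
  cT (fvar a) = []
  cT (con c)  = c ∷ []
  cT (eps A)  = cF A

  cTs : ∀ {n} → List (Term n) → List ℕ
  cTs []       = []
  cTs (t ∷ ts) = cT t ++ cTs ts

  cF : ∀ {n} → Formula n → List ℕ
  cF (atom P ts) = cTs ts
  cF ⊥'          = []
  cF (A & B)     = cF A ++ cF B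
  cF (A ∨' B)    = cF A ++ cF B
  cF (A ⇒ B)     = cF A ++ cF B
  cF (all A)     = cF A
  cF (ex A)      = cF A

⊤' : Fm
⊤' = ⊥' ⇒ ⊥'

-- t↓ : ⊤ for variables/constants;  ∃y(∃x A(x) → A(y)) for t = ε x A(x).
-- Inside ∃y ∃x, the copy of A has its bound variable pointing to x (index 0);
-- inside ∃y alone, A(y) is A itself.
_↓ : Tm → Fm
bvar () ↓
fvar a ↓ = ⊤'
con c ↓  = ⊤'
eps A ↓  = ex (ex (renF (λ _ → zero) A) ⇒ A)

-- The sequent calculus IPCε.  Antecedents are lists, read as sets: the
-- rule `setEq` identifies antecedents with the same elements.

infix 2 _⊢_

data _⊢_ : List Fm → Fm → Set where
  setEq : ∀ {Γ Γ' G} → Γ ⊢ G → Γ ⊆ Γ' → Γ' ⊆ Γ → Γ' ⊢ G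
  ax    : ∀ {Γ A} → A ∷ Γ ⊢ A
  ⊥L    : ∀ {Γ A} → ⊥' ∷ Γ ⊢ A
  &R    : ∀ {Γ A B} → Γ ⊢ A → Γ ⊢ B → Γ ⊢ A & B
  &L    : ∀ {Γ A B G} → A ∷ B ∷ Γ ⊢ G → (A & B) ∷ Γ ⊢ G
  ∨R₁   : ∀ {Γ A B} → Γ ⊢ A → Γ ⊢ A ∨' B
  ∨R₂   : ∀ {Γ A B} → Γ ⊢ B → Γ ⊢ A ∨' B
  ∨L    : ∀ {Γ A B G} → A ∷ Γ ⊢ G → B ∷ Γ ⊢ G → (A ∨' B) ∷ Γ ⊢ G
  ⇒R    : ∀ {Γ A B} → A ∷ Γ ⊢ B → Γ ⊢ A ⇒ B
  ⇒L    : ∀ {Γ A B G} → Γ ⊢ A → B ∷ Γ ⊢ G → (A ⇒ B) ∷ Γ ⊢ G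
  ∀R    : ∀ {Γ F} (a : ℕ) → a ∉ concatMap fvF Γ → a ∉ fvF (all F) →
          Γ ⊢ inst F (fvar a) → Γ ⊢ all F
  ∀L    : ∀ {Γ Δ F G} (t : Tm) → Γ ⊢ t ↓ → inst F t ∷ Δ ⊢ G →
          all F ∷ (Γ ++ Δ) ⊢ G
  ∃R    : ∀ {Γ F} (t : Tm) → Γ ⊢ t ↓ → Γ ⊢ inst F t → Γ ⊢ ex F
  ∃L    : ∀ {Γ A G} → inst A (eps A) ∷ Γ ⊢ G → ex A ∷ Γ ⊢ G
  cut   : ∀ {Γ Δ A G} → Γ ⊢ A → A ∷ Δ ⊢ G → Γ ++ Δ ⊢ G

-- D₁ ∨ … ∨ Dₙ  (empty disjunction = ⊥)
⋁ : List Fm → Fm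
⋁ []           = ⊥'
⋁ (D ∷ [])     = D
⋁ (D ∷ E ∷ Ds) = D ∨' ⋁ (E ∷ Ds)

record ISeq : Set₁ where
  field
    ant : Fm → Set
    suc' : Fm → Set
    fresh : ∀ (n : ℕ) → ∃[ a ] (n ≤ a ×
              (∀ (A : Fm) → (ant A ⊎ suc' A) → a ∉ fvF A))

open ISeq public

OccVar : ISeq → ℕ → Set
OccVar w a = ∃[ A ] ((ant w A ⊎ suc' w A) × a ∈ fvF A)

OccCon : ISeq → ℕ → Set
OccCon w c = ∃[ A ] ((ant w A ⊎ suc' w A) × c ∈ cF A)

InLF : ISeq → Fm → Set
InLF w A = (∀ a → a ∈ fvF A → OccVar w a) × (∀ c → c ∈ cF A → OccCon w c)

InLT : ISeq → Tm → Set
InLT w t = (∀ a → a ∈ fvT t → OccVar w a) × (∀ c → c ∈ cT t → OccCon w c)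

D : ISeq → Tm → Set
D w t = InLT w t × ant w (t ↓)

Consistent : ISeq → Set
Consistent w = ∀ (Γ Ds : List Fm) → All (ant w) Γ → All (suc' w) Ds →
               ¬ (Γ ⊢ ⋁ Ds)

MaxConsistent : ISeq → Set
MaxConsistent w = Consistent w × (∀ (A : Fm) → InLF w A → ant w A ⊎ suc' w A)

_≺_ : ISeq → ISeq → Set
w ≺ w' = (∀ (A : Fm) → ant w A → ant w' A) × (∀ (t : Tm) → D w t → D w' t)

-- Both parts of the theorem are instances of one Lindenbaum lemma: given a
-- set Γ₀ ⊇ w_a and a formula G, all in the language of w enlarged by a set V
-- of variables that still misses infinitely many variables, if no finite
-- part of Γ₀ derives G then there is a maximal consistent w' > w with
-- Γ₀ ⊆ w'_a, G ∈ w'_s and every variable of V occurring in w'.  For (i) take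
-- Γ₀ = w_a ∪ {A}, G = B; for (ii) take a fresh variable a, Γ₀ = w_a,
-- G = A(a), V = variables of w plus a, where ∀R turns a derivation of A(a)
-- into one of ∀xA(x).
--
-- Excluded
-- middle is used to decide membership and derivability.

module Submission where

open import Defs
open import Level using (0ℓ)
open import Axiom.ExcludedMiddle using (ExcludedMiddle)
open import Data.Nat using (ℕ; zero; suc; _+_; _≤_)
open import Data.Nat.Properties using (+-comm; ≤-trans; m≤m+n; m≤n+m; <-irrefl)
open import Data.Nat.Binary.Base using (ℕᵇ; 2[1+_]; 1+[2_]) renaming (zero to 0ᵇ; toℕ to toℕᵇ)
open import Data.Nat.Binary.Properties using (toℕ-injective)
open import Data.Fin using (Fin; zero; suc)
open import Data.List using (List; []; _∷_; _++_; concatMap)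
open import Data.List.Membership.Propositional using (_∈_; _∉_)
open import Data.List.Membership.Propositional.Properties using (∈-++⁻; ∈-++⁺ˡ; ∈-++⁺ʳ)
open import Data.List.Relation.Binary.Subset.Propositional using (_⊆_)
open import Data.List.Relation.Binary.Subset.Propositional.Properties using (xs⊆xs++ys; xs⊆ys++xs; ∷⁺ʳ)
open import Data.List.Relation.Unary.All using (All; []; _∷_)
import Data.List.Relation.Unary.All as All
open import Data.List.Relation.Unary.All.Properties using (++⁺)
open import Data.List.Relation.Unary.Any using (here; there)
open import Data.Maybe using (Maybe; just; nothing)
import Data.Maybe as Maybe
open import Data.Maybe.Properties using (just-injective)
open import Data.Product using (∃-syntax; _×_; _,_; proj₁; proj₂)
open import Data.Sum using (_⊎_; inj₁; inj₂; [_,_])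
open import Data.Empty using (⊥-elim)
open import Function using (id)
open import Relation.Nullary using (¬_; yes; no)
open import Relation.Binary.PropositionalEquality using (_≡_; refl; sym; trans; cong; cong₂; subst; module ≡-Reasoning)

-- Rose trees labelled by naturals: a universal syntax into which terms and
-- formulas embed, so that one code into ℕ serves for all of them.
data Tree : Set where
  node : ℕ → List Tree → Tree

finTree : ∀ {n} → Fin n → Tree
finTree zero    = node 0 []
finTree (suc i) = node 1 (finTree i ∷ [])

mutual
  termTree : ∀ {n} → Term n → Tree
  termTree (bvar i) = node 0 (finTree i ∷ [])
  termTree (fvar a) = node 1 (node a [] ∷ [])
  termTree (con c)  = node 2 (node c [] ∷ [])
  termTree (eps A)  = node 3 (formulaTree A ∷ [])

  termsTree : ∀ {n} → List (Term n) → List Tree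
  termsTree []       = []
  termsTree (t ∷ ts) = termTree t ∷ termsTree ts

  formulaTree : ∀ {n} → Formula n → Tree
  formulaTree (atom P ts) = node 0 (node P [] ∷ termsTree ts)
  formulaTree ⊥'          = node 1 []
  formulaTree (A & B)     = node 2 (formulaTree A ∷ formulaTree B ∷ [])
  formulaTree (A ∨' B)    = node 3 (formulaTree A ∷ formulaTree B ∷ [])
  formulaTree (A ⇒ B)     = node 4 (formulaTree A ∷ formulaTree B ∷ [])
  formulaTree (all A)     = node 5 (formulaTree A ∷ [])
  formulaTree (ex A)      = node 6 (formulaTree A ∷ [])

-- Partial inverses of the tree encodings; they make the encodings injective.
readFin : ∀ {n} → Tree → Maybe (Fin n)
readFin {suc n} (node 0 [])       = just zero
readFin {suc n} (node 1 (t ∷ [])) = Maybe.map suc (readFin t)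
readFin _                         = nothing

mutual
  readTerm : ∀ {n} → Tree → Maybe (Term n)
  readTerm (node 0 (t ∷ []))           = Maybe.map bvar (readFin t)
  readTerm (node 1 (node a [] ∷ []))   = just (fvar a)
  readTerm (node 2 (node c [] ∷ []))   = just (con c)
  readTerm (node 3 (t ∷ []))           = Maybe.map eps (readFormula t)
  readTerm _                           = nothing

  readTerms : ∀ {n} → List Tree → Maybe (List (Term n))
  readTerms []       = just []
  readTerms (t ∷ ts) = Maybe.zipWith _∷_ (readTerm t) (readTerms ts)

  readFormula : ∀ {n} → Tree → Maybe (Formula n)
  readFormula (node 0 (node P [] ∷ ts)) = Maybe.map (atom P) (readTerms ts)
  readFormula (node 1 [])               = just ⊥'
  readFormula (node 2 (a ∷ b ∷ []))     = Maybe.zipWith _&_ (readFormula a) (readFormula b)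
  readFormula (node 3 (a ∷ b ∷ []))     = Maybe.zipWith _∨'_ (readFormula a) (readFormula b)
  readFormula (node 4 (a ∷ b ∷ []))     = Maybe.zipWith _⇒_ (readFormula a) (readFormula b)
  readFormula (node 5 (a ∷ []))         = Maybe.map all (readFormula a)
  readFormula (node 6 (a ∷ []))         = Maybe.map ex (readFormula a)
  readFormula _                         = nothing

readFin-finTree : ∀ {n} (i : Fin n) → readFin (finTree i) ≡ just i
readFin-finTree zero    = refl
readFin-finTree (suc i) rewrite readFin-finTree i = refl

mutual
  readTerm-termTree : ∀ {n} (t : Term n) → readTerm (termTree t) ≡ just t
  readTerm-termTree (bvar i) rewrite readFin-finTree i = refl
  readTerm-termTree (fvar a) = refl
  readTerm-termTree (con c)  = refl
  readTerm-termTree (eps A) rewrite readFormula-formulaTree A = refl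

  readTerms-termsTree : ∀ {n} (ts : List (Term n)) → readTerms (termsTree ts) ≡ just ts
  readTerms-termsTree []       = refl
  readTerms-termsTree (t ∷ ts) rewrite readTerm-termTree t | readTerms-termsTree ts = refl

  readFormula-formulaTree : ∀ {n} (A : Formula n) → readFormula (formulaTree A) ≡ just A
  readFormula-formulaTree (atom P ts) rewrite readTerms-termsTree ts = refl
  readFormula-formulaTree ⊥' = refl
  readFormula-formulaTree (A & B) rewrite readFormula-formulaTree A | readFormula-formulaTree B = refl
  readFormula-formulaTree (A ∨' B) rewrite readFormula-formulaTree A | readFormula-formulaTree B = refl
  readFormula-formulaTree (A ⇒ B) rewrite readFormula-formulaTree A | readFormula-formulaTree B = refl
  readFormula-formulaTree (all A) rewrite readFormula-formulaTree A = refl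
  readFormula-formulaTree (ex A) rewrite readFormula-formulaTree A = refl

formulaTree-injective : ∀ {n} {A B : Formula n} → formulaTree A ≡ formulaTree B → A ≡ B
formulaTree-injective {A = A} {B} eq = just-injective (begin
  just A                    ≡⟨ sym (readFormula-formulaTree A) ⟩
  readFormula (formulaTree A) ≡⟨ cong readFormula eq ⟩
  readFormula (formulaTree B) ≡⟨ readFormula-formulaTree B ⟩
  just B                    ∎)
  where open ≡-Reasoning

-- A prefix code of trees into binary naturals, written in continuation
-- style: the digit 2[1+_] is a "1" bit and 1+[2_] a "0" bit, a natural k is
-- written as k ones followed by a zero, a list as a one before each element
-- and a closing zero.
lastDigit : ℕᵇ → ℕᵇ
lastDigit 0ᵇ       = 0ᵇ
lastDigit 2[1+ x ] = x
lastDigit 1+[2 x ] = x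

natCode : ℕ → ℕᵇ → ℕᵇ
natCode zero    r = 1+[2 r ]
natCode (suc k) r = 2[1+ natCode k r ]

mutual
  treeCode : Tree → ℕᵇ → ℕᵇ
  treeCode (node k ts) r = natCode k (treesCode ts r)

  treesCode : List Tree → ℕᵇ → ℕᵇ
  treesCode []       r = 1+[2 r ]
  treesCode (t ∷ ts) r = 2[1+ treeCode t (treesCode ts r) ]

natCode-injective : ∀ k l {r s} → natCode k r ≡ natCode l s → k ≡ l × r ≡ s
natCode-injective zero    zero    eq = refl , cong lastDigit eq
natCode-injective (suc k) (suc l) eq with natCode-injective k l (cong lastDigit eq)
... | refl , r≡s = refl , r≡s

mutual
  treeCode-injective : ∀ t u {r s} → treeCode t r ≡ treeCode u s → t ≡ u × r ≡ s
  treeCode-injective (node k ts) (node l us) eq with natCode-injective k l eq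
  ... | refl , eq′ with treesCode-injective ts us eq′
  ...   | refl , r≡s = refl , r≡s

  treesCode-injective : ∀ ts us {r s} → treesCode ts r ≡ treesCode us s → ts ≡ us × r ≡ s
  treesCode-injective []       []       eq = refl , cong lastDigit eq
  treesCode-injective (t ∷ ts) (u ∷ us) eq with treeCode-injective t u (cong lastDigit eq)
  ... | refl , eq′ with treesCode-injective ts us eq′
  ...   | refl , r≡s = refl , r≡s

index : Fm → ℕ
index A = toℕᵇ (treeCode (formulaTree A) 0ᵇ)

index-injective : ∀ {A B} → index A ≡ index B → A ≡ B
index-injective {A} {B} eq =
  formulaTree-injective (proj₁ (treeCode-injective (formulaTree A) (formulaTree B) (toℕ-injective eq)))

mutual
  fvT-renT : ∀ {m k} (ρ : Fin m → Fin k) (t : Term m) → fvT (renT ρ t) ≡ fvT t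
  fvT-renT ρ (bvar i) = refl
  fvT-renT ρ (fvar a) = refl
  fvT-renT ρ (con c)  = refl
  fvT-renT ρ (eps A)  = fvF-renF (liftR ρ) A

  fvTs-renTs : ∀ {m k} (ρ : Fin m → Fin k) (ts : List (Term m)) → fvTs (renTs ρ ts) ≡ fvTs ts
  fvTs-renTs ρ []       = refl
  fvTs-renTs ρ (t ∷ ts) = cong₂ _++_ (fvT-renT ρ t) (fvTs-renTs ρ ts)

  fvF-renF : ∀ {m k} (ρ : Fin m → Fin k) (A : Formula m) → fvF (renF ρ A) ≡ fvF A
  fvF-renF ρ (atom P ts) = fvTs-renTs ρ ts
  fvF-renF ρ ⊥'          = refl
  fvF-renF ρ (A & B)     = cong₂ _++_ (fvF-renF ρ A) (fvF-renF ρ B)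
  fvF-renF ρ (A ∨' B)    = cong₂ _++_ (fvF-renF ρ A) (fvF-renF ρ B)
  fvF-renF ρ (A ⇒ B)     = cong₂ _++_ (fvF-renF ρ A) (fvF-renF ρ B)
  fvF-renF ρ (all A)     = fvF-renF (liftR ρ) A
  fvF-renF ρ (ex A)      = fvF-renF (liftR ρ) A

mutual
  cT-renT : ∀ {m k} (ρ : Fin m → Fin k) (t : Term m) → cT (renT ρ t) ≡ cT t
  cT-renT ρ (bvar i) = refl
  cT-renT ρ (fvar a) = refl
  cT-renT ρ (con c)  = refl
  cT-renT ρ (eps A)  = cF-renF (liftR ρ) A

  cTs-renTs : ∀ {m k} (ρ : Fin m → Fin k) (ts : List (Term m)) → cTs (renTs ρ ts) ≡ cTs ts
  cTs-renTs ρ []       = refl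
  cTs-renTs ρ (t ∷ ts) = cong₂ _++_ (cT-renT ρ t) (cTs-renTs ρ ts)

  cF-renF : ∀ {m k} (ρ : Fin m → Fin k) (A : Formula m) → cF (renF ρ A) ≡ cF A
  cF-renF ρ (atom P ts) = cTs-renTs ρ ts
  cF-renF ρ ⊥'          = refl
  cF-renF ρ (A & B)     = cong₂ _++_ (cF-renF ρ A) (cF-renF ρ B)
  cF-renF ρ (A ∨' B)    = cong₂ _++_ (cF-renF ρ A) (cF-renF ρ B)
  cF-renF ρ (A ⇒ B)     = cong₂ _++_ (cF-renF ρ A) (cF-renF ρ B)
  cF-renF ρ (all A)     = cF-renF (liftR ρ) A
  cF-renF ρ (ex A)      = cF-renF (liftR ρ) A

++-split-map : ∀ {R : Set} {v : ℕ} (xs : List ℕ) {ys xs′ ys′ : List ℕ} →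
  (v ∈ xs → v ∈ xs′ ⊎ R) → (v ∈ ys → v ∈ ys′ ⊎ R) → v ∈ xs ++ ys → v ∈ xs′ ++ ys′ ⊎ R
++-split-map xs {xs′ = xs′} f g p with ∈-++⁻ xs p
... | inj₁ q = Data.Sum.map₁ ∈-++⁺ˡ (f q)
... | inj₂ q = Data.Sum.map₁ (∈-++⁺ʳ xs′) (g q)

FvOf : ∀ {m k} → (Fin m → Term k) → ℕ → Set
FvOf σ v = ∃[ i ] (v ∈ fvT (σ i))

FvOf-liftS : ∀ {m k} (σ : Fin m → Term k) {v} → FvOf (liftS σ) v → FvOf σ v
FvOf-liftS σ (suc i , p) = i , subst (_ ∈_) (fvT-renT suc (σ i)) p

mutual
  fvT-subT : ∀ {m k} (σ : Fin m → Term k) (t : Term m) {v} → v ∈ fvT (subT σ t) → v ∈ fvT t ⊎ FvOf σ v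
  fvT-subT σ (bvar i) p = inj₂ (i , p)
  fvT-subT σ (fvar a) p = inj₁ p
  fvT-subT σ (eps A)  p = Data.Sum.map₂ (FvOf-liftS σ) (fvF-subF (liftS σ) A p)

  fvTs-subTs : ∀ {m k} (σ : Fin m → Term k) (ts : List (Term m)) {v} → v ∈ fvTs (subTs σ ts) → v ∈ fvTs ts ⊎ FvOf σ v
  fvTs-subTs σ (t ∷ ts) = ++-split-map (fvT (subT σ t)) (fvT-subT σ t) (fvTs-subTs σ ts)

  fvF-subF : ∀ {m k} (σ : Fin m → Term k) (A : Formula m) {v} → v ∈ fvF (subF σ A) → v ∈ fvF A ⊎ FvOf σ v
  fvF-subF σ (atom P ts) = fvTs-subTs σ ts
  fvF-subF σ (A & B)     = ++-split-map (fvF (subF σ A)) (fvF-subF σ A) (fvF-subF σ B)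
  fvF-subF σ (A ∨' B)    = ++-split-map (fvF (subF σ A)) (fvF-subF σ A) (fvF-subF σ B)
  fvF-subF σ (A ⇒ B)     = ++-split-map (fvF (subF σ A)) (fvF-subF σ A) (fvF-subF σ B)
  fvF-subF σ (all A) p   = Data.Sum.map₂ (FvOf-liftS σ) (fvF-subF (liftS σ) A p)
  fvF-subF σ (ex A)  p   = Data.Sum.map₂ (FvOf-liftS σ) (fvF-subF (liftS σ) A p)

CsOf : ∀ {m k} → (Fin m → Term k) → ℕ → Set
CsOf σ c = ∃[ i ] (c ∈ cT (σ i))

CsOf-liftS : ∀ {m k} (σ : Fin m → Term k) {c} → CsOf (liftS σ) c → CsOf σ c
CsOf-liftS σ (suc i , p) = i , subst (_ ∈_) (cT-renT suc (σ i)) p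

mutual
  cT-subT : ∀ {m k} (σ : Fin m → Term k) (t : Term m) {c} → c ∈ cT (subT σ t) → c ∈ cT t ⊎ CsOf σ c
  cT-subT σ (bvar i) p = inj₂ (i , p)
  cT-subT σ (con c)  p = inj₁ p
  cT-subT σ (eps A)  p = Data.Sum.map₂ (CsOf-liftS σ) (cF-subF (liftS σ) A p)

  cTs-subTs : ∀ {m k} (σ : Fin m → Term k) (ts : List (Term m)) {c} → c ∈ cTs (subTs σ ts) → c ∈ cTs ts ⊎ CsOf σ c
  cTs-subTs σ (t ∷ ts) = ++-split-map (cT (subT σ t)) (cT-subT σ t) (cTs-subTs σ ts)

  cF-subF : ∀ {m k} (σ : Fin m → Term k) (A : Formula m) {c} → c ∈ cF (subF σ A) → c ∈ cF A ⊎ CsOf σ c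
  cF-subF σ (atom P ts) = cTs-subTs σ ts
  cF-subF σ (A & B)     = ++-split-map (cF (subF σ A)) (cF-subF σ A) (cF-subF σ B)
  cF-subF σ (A ∨' B)    = ++-split-map (cF (subF σ A)) (cF-subF σ A) (cF-subF σ B)
  cF-subF σ (A ⇒ B)     = ++-split-map (cF (subF σ A)) (cF-subF σ A) (cF-subF σ B)
  cF-subF σ (all A) p   = Data.Sum.map₂ (CsOf-liftS σ) (cF-subF (liftS σ) A p)
  cF-subF σ (ex A)  p   = Data.Sum.map₂ (CsOf-liftS σ) (cF-subF (liftS σ) A p)

fvF-inst-var : ∀ (A : Formula 1) a {v} → v ∈ fvF (inst A (fvar a)) → v ∈ fvF A ⊎ v ≡ a
fvF-inst-var A a p with fvF-subF (λ _ → fvar a) A p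
... | inj₁ q              = inj₁ q
... | inj₂ (_ , here v≡a) = inj₂ v≡a

cF-inst-var : ∀ (A : Formula 1) a {c} → c ∈ cF (inst A (fvar a)) → c ∈ cF A
cF-inst-var A a p with cF-subF (λ _ → fvar a) A p
... | inj₁ q = q

weaken : ∀ {Γ Γ′ H} → Γ ⊢ H → Γ ⊆ Γ′ → Γ′ ⊢ H
weaken {Γ} {Γ′} d Γ⊆Γ′ =
  setEq (cut d ax) (λ p → [ Γ⊆Γ′ , id ] (∈-++⁻ Γ p)) (xs⊆ys++xs Γ′ Γ)

_+₁_ : (Fm → Set) → Fm → Fm → Set
(P +₁ Y) X = P X ⊎ X ≡ Y

remove₁ : ∀ {P Y} Γ → All (P +₁ Y) Γ → ∃[ Δ ] (All P Δ × Γ ⊆ Y ∷ Δ)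
remove₁ []      []                = [] , [] , λ ()
remove₁ (X ∷ Γ) (inj₂ refl ∷ Γ∈) with remove₁ Γ Γ∈
... | Δ , Δ∈ , Γ⊆ = Δ , Δ∈ , λ { (here refl) → here refl ; (there p) → Γ⊆ p }
remove₁ (X ∷ Γ) (inj₁ X∈ ∷ Γ∈)   with remove₁ Γ Γ∈
... | Δ , Δ∈ , Γ⊆ = X ∷ Δ , X∈ ∷ Δ∈ , λ { (here refl) → there (here refl) ; (there p) → lift (Γ⊆ p) }
  where
  lift : ∀ {Z} → Z ∈ _ ∷ Δ → Z ∈ _ ∷ X ∷ Δ
  lift (here e)  = here e
  lift (there q) = there (there q)

RefutesOver : (Fm → Set) → Fm → Fm → Set
RefutesOver P G D = ∃[ Δ ] (All P Δ × (D ∷ Δ ⊢ G))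

⋁-refutes : ∀ {P G} Ds → All (RefutesOver P G) Ds → RefutesOver P G (⋁ Ds)
⋁-refutes []           []        = [] , [] , ⊥L
⋁-refutes (D ∷ [])     (r ∷ [])  = r
⋁-refutes (D ∷ E ∷ Ds) ((Δ₁ , Δ₁∈ , d₁) ∷ rs) with ⋁-refutes (E ∷ Ds) rs
... | Δ₂ , Δ₂∈ , d₂ = Δ₁ ++ Δ₂ , ++⁺ Δ₁∈ Δ₂∈ ,
  ∨L (weaken d₁ (∷⁺ʳ D (xs⊆xs++ys Δ₁ Δ₂))) (weaken d₂ (∷⁺ʳ _ (xs⊆ys++xs Δ₂ Δ₁)))

-- A maximal consistent sequent proves ⊤: it is in its language and cannot be
-- in the succedent.
maxConsistent-⊤ : ∀ {w} → MaxConsistent w → ant w ⊤'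
maxConsistent-⊤ {w} (consistent , maximal) with maximal ⊤' ((λ _ ()) , (λ _ ()))
... | inj₁ ⊤∈ = ⊤∈
... | inj₂ ⊤∈ = ⊥-elim (consistent [] (⊤' ∷ []) [] (⊤∈ ∷ []) (⇒R ⊥L))

InLanguage : ISeq → (ℕ → Set) → Fm → Set
InLanguage w V X = (∀ v → v ∈ fvF X → V v) × (∀ c → c ∈ cF X → OccCon w c)

ant-InLF : ∀ w {X} → ant w X → InLF w X
ant-InLF w X∈ = (λ v p → _ , inj₁ X∈ , p) , (λ c p → _ , inj₁ X∈ , p)

⇒-InLF : ∀ w {A B} → suc' w (A ⇒ B) → InLF w A × InLF w B
⇒-InLF w {A} h = ((λ v p → _ , inj₂ h , ∈-++⁺ˡ p) , (λ c p → _ , inj₂ h , ∈-++⁺ˡ p))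
               , ((λ v p → _ , inj₂ h , ∈-++⁺ʳ (fvF A) p) , (λ c p → _ , inj₂ h , ∈-++⁺ʳ (cF A) p))

InfinitelyFresh : (ℕ → Set) → Set
InfinitelyFresh V = ∀ n → ∃[ b ] (n ≤ b × ¬ V b)

occVar-fresh : ∀ w → InfinitelyFresh (OccVar w)
occVar-fresh w n with fresh w n
... | b , n≤b , b∉ = b , n≤b , λ (X , X∈ , p) → b∉ X X∈ p

insert-fresh : ∀ {V} a → InfinitelyFresh V → InfinitelyFresh (λ v → V v ⊎ v ≡ a)
insert-fresh {V} a V-fresh n with V-fresh (n + suc a)
... | b , n+1+a≤b , b∉V = b , ≤-trans (m≤m+n n (suc a)) n+1+a≤b , b∉
  where
  b∉ : ¬ (V b ⊎ b ≡ a)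
  b∉ (inj₁ b∈V) = b∉V b∈V
  b∉ (inj₂ refl) = <-irrefl refl (≤-trans (m≤n+m (suc a) n) n+1+a≤b)

record Extension (w : ISeq) (V : ℕ → Set) (Γ₀ : Fm → Set) (G : Fm) : Set₁ where
  field
    seq         : ISeq
    maxCons     : MaxConsistent seq
    extends     : w ≺ seq
    contains-Γ₀ : ∀ X → Γ₀ X → ant seq X
    contains-G  : suc' seq G
    occurs-V    : ∀ v → V v → OccVar seq v

module Lindenbaum (em : ExcludedMiddle 0ℓ) (w : ISeq) (V : ℕ → Set) (Γ₀ : Fm → Set) (G : Fm) where

  Underivable : (Fm → Set) → Set
  Underivable P = ∀ Γ → All P Γ → ¬ (Γ ⊢ G)

  mutual
    Stage : ℕ → Fm → Set
    Stage zero    = Γ₀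
    Stage (suc n) X = Stage n X ⊎ Admitted n X

    Admitted : ℕ → Fm → Set
    Admitted n X = index X ≡ n × InLanguage w V X × Underivable (Stage n +₁ X)

  Limit : Fm → Set
  Limit X = ∃[ n ] Stage n X

  -- Only one formula is admitted per stage, by injectivity of the index.
  one-admitted : ∀ n Γ → All (Stage (suc n)) Γ →
    All (Stage n) Γ ⊎ ∃[ Y ] (Admitted n Y × All (Stage n +₁ Y) Γ)
  one-admitted n []      []       = inj₁ []
  one-admitted n (X ∷ Γ) (X∈ ∷ Γ∈) with X∈ | one-admitted n Γ Γ∈
  ... | inj₁ old | inj₁ olds          = inj₁ (old ∷ olds)
  ... | inj₁ old | inj₂ (Y , adm , Γ⊆) = inj₂ (Y , adm , inj₁ old ∷ Γ⊆)
  ... | inj₂ adm | inj₁ olds          = inj₂ (X , adm , inj₂ refl ∷ All.map inj₁ olds)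
  ... | inj₂ adm | inj₂ (Y , adm′ , Γ⊆) =
    inj₂ (Y , adm′ , inj₂ (index-injective (trans (proj₁ adm) (sym (proj₁ adm′)))) ∷ Γ⊆)

  stage-mono : ∀ k {n X} → Stage n X → Stage (k + n) X
  stage-mono zero    s = s
  stage-mono (suc k) s = inj₁ (stage-mono k s)

  limit-finite : ∀ Γ → All Limit Γ → ∃[ n ] All (Stage n) Γ
  limit-finite []      []              = 0 , []
  limit-finite (X ∷ Γ) ((k , X∈) ∷ Γ∈) with limit-finite Γ Γ∈
  ... | m , Γ⊆ = m + k , stage-mono m X∈ ∷ All.map (λ {Y} Y∈ → subst (λ j → Stage j Y) (+-comm k m) (stage-mono k Y∈)) Γ⊆

  module _ (Γ₀-lang : ∀ X → Γ₀ X → InLanguage w V X) (Γ₀-underivable : Underivable Γ₀)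
           (G-lang : InLanguage w V G) (V-fresh : InfinitelyFresh V) (V⊇w : ∀ v → OccVar w v → V v) where

    stage-underivable : ∀ n → Underivable (Stage n)
    stage-underivable zero    = Γ₀-underivable
    stage-underivable (suc n) Γ Γ∈ with one-admitted n Γ Γ∈
    ... | inj₁ Γ⊆            = stage-underivable n Γ Γ⊆
    ... | inj₂ (_ , adm , Γ⊆) = proj₂ (proj₂ adm) Γ Γ⊆

    stage-lang : ∀ n X → Stage n X → InLanguage w V X
    stage-lang zero    X X∈          = Γ₀-lang X X∈
    stage-lang (suc n) X (inj₁ X∈)   = stage-lang n X X∈
    stage-lang (suc n) X (inj₂ adm)  = proj₁ (proj₂ adm)

    -- A formula of the language left out of the limit refutes G over it:
    -- it was rejected at the stage of its index.
    rejected-refutes : ∀ X → InLanguage w V X → ¬ Limit X → RefutesOver Limit G X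
    rejected-refutes X X-lang X∉ with em {∃[ Γ ] (All (Stage (index X) +₁ X) Γ × (Γ ⊢ G))}
    ... | yes (Γ , Γ⊆ , d) with remove₁ Γ Γ⊆
    ...   | Δ , Δ∈ , Γ⊆XΔ = Δ , All.map (λ s → index X , s) Δ∈ , weaken d Γ⊆XΔ
    rejected-refutes X X-lang X∉ | no none =
      ⊥-elim (X∉ (suc (index X) , inj₂ (refl , X-lang , λ Γ Γ⊆ d → none (Γ , Γ⊆ , d))))

    Rejected : Fm → Set
    Rejected X = InLanguage w V X × ¬ Limit X

    limit-or-rejected : ∀ X → InLanguage w V X → Limit X ⊎ Rejected X
    limit-or-rejected X X-lang with em {Limit X}
    ... | yes X∈ = inj₁ X∈
    ... | no  X∉ = inj₂ (X-lang , X∉)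

    member-lang : ∀ X → Limit X ⊎ Rejected X → InLanguage w V X
    member-lang X (inj₁ (n , X∈)) = stage-lang n X X∈
    member-lang X (inj₂ (X-lang , _)) = X-lang

    w′ : ISeq
    w′ = record { ant = Limit ; suc' = Rejected ; fresh = w′-fresh }
      where
      w′-fresh : ∀ n → ∃[ b ] (n ≤ b × (∀ X → Limit X ⊎ Rejected X → b ∉ fvF X))
      w′-fresh n with V-fresh n
      ... | b , n≤b , b∉V = b , n≤b , λ X X∈ p → b∉V (proj₁ (member-lang X X∈) b p)

    w′-consistent : Consistent w′
    w′-consistent Γ Ds Γ∈ Ds∈ d
      with ⋁-refutes Ds (All.map (λ {D} (D-lang , D∉) → rejected-refutes D D-lang D∉) Ds∈)
    ... | Δ , Δ∈ , e with limit-finite (Γ ++ Δ) (++⁺ Γ∈ Δ∈)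
    ...   | n , ΓΔ∈ = stage-underivable n (Γ ++ Δ) ΓΔ∈ (cut d e)

    -- Every symbol of w′ comes from V or from the constants of w, so L_w′ is
    -- contained in the language, where membership is decided.
    w′-maximal : ∀ X → InLF w′ X → Limit X ⊎ Rejected X
    w′-maximal X (vars , cons) = limit-or-rejected X
      ( (λ v p → let (Y , Y∈ , q) = vars v p in proj₁ (member-lang Y Y∈) v q)
      , (λ c p → let (Y , Y∈ , q) = cons c p in proj₂ (member-lang Y Y∈) c q))

    -- Each symbol of the language occurs in w′, through the atom P₀(symbol).
    symbolAtom : Tm → Fm
    symbolAtom t = atom 0 (t ∷ [])

    occurs-V : ∀ v → V v → OccVar w′ v
    occurs-V v v∈V = symbolAtom (fvar v) , limit-or-rejected _ (lang , λ _ ()) , here refl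
      where
      lang : ∀ u → u ∈ fvF (symbolAtom (fvar v)) → V u
      lang u (here refl) = v∈V

    occurs-con : ∀ c → OccCon w c → OccCon w′ c
    occurs-con c c∈w = symbolAtom (con c) , limit-or-rejected _ ((λ _ ()) , lang) , here refl
      where
      lang : ∀ d → d ∈ cF (symbolAtom (con c)) → OccCon w d
      lang d (here refl) = c∈w

    extension : (∀ X → ant w X → Γ₀ X) → Extension w V Γ₀ G
    extension w⊆Γ₀ = record
      { seq         = w′
      ; maxCons     = w′-consistent , w′-maximal
      ; extends     = (λ X X∈ → 0 , w⊆Γ₀ X X∈)
                    , λ t ((vars , cons) , t↓) →
                        ( (λ v p → occurs-V v (V⊇w v (vars v p)))
                        , (λ c p → occurs-con c (cons c p)))
                      , (0 , w⊆Γ₀ _ t↓)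
      ; contains-Γ₀ = λ X X∈ → 0 , X∈
      ; contains-G  = G-lang , λ (n , G∈) → stage-underivable n (G ∷ []) (G∈ ∷ []) ax
      ; occurs-V    = occurs-V
      }

fresh-in-ant : ∀ w a → (∀ X → ant w X ⊎ suc' w X → a ∉ fvF X) →
  ∀ Γ → All (ant w) Γ → a ∉ concatMap fvF Γ
fresh-in-ant w a a∉ (X ∷ Γ) (X∈ ∷ Γ∈) p with ∈-++⁻ (fvF X) p
... | inj₁ q = a∉ X (inj₁ X∈) q
... | inj₂ q = fresh-in-ant w a a∉ Γ Γ∈ q

implication-extension : ExcludedMiddle 0ℓ → ∀ w → Consistent w → ∀ A B → suc' w (A ⇒ B) →
  Extension w (OccVar w) (ant w +₁ A) B
implication-extension em w consistent A B h =
  extension Γ₀-lang Γ₀-underivable (proj₂ (⇒-InLF w h)) (occVar-fresh w) (λ _ o → o) (λ _ → inj₁)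
  where
  open Lindenbaum em w (OccVar w) (ant w +₁ A) B
  Γ₀-lang : ∀ X → (ant w +₁ A) X → InLF w X
  Γ₀-lang X (inj₁ X∈) = ant-InLF w X∈
  Γ₀-lang X (inj₂ refl) = proj₁ (⇒-InLF w h)
  -- Γ, A ⊢ B with Γ ⊆ w_a would give Γ ⊢ A ⇒ B against consistency.
  Γ₀-underivable : Underivable (ant w +₁ A)
  Γ₀-underivable Γ Γ∈ d with remove₁ Γ Γ∈
  ... | Δ , Δ∈ , Γ⊆AΔ = consistent Δ ((A ⇒ B) ∷ []) Δ∈ (h ∷ []) (⇒R (weaken d Γ⊆AΔ))

universal-extension : ExcludedMiddle 0ℓ → ∀ w → Consistent w → ∀ A → suc' w (all A) →
  ∀ a → (∀ X → ant w X ⊎ suc' w X → a ∉ fvF X) →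
  Extension w (λ v → OccVar w v ⊎ v ≡ a) (ant w) (inst A (fvar a))
universal-extension em w consistent A h a a∉ =
  extension Γ₀-lang Γ₀-underivable G-lang (insert-fresh a (occVar-fresh w)) (λ _ → inj₁) (λ _ X∈ → X∈)
  where
  open Lindenbaum em w (λ v → OccVar w v ⊎ v ≡ a) (ant w) (inst A (fvar a))
  Γ₀-lang : ∀ X → ant w X → InLanguage w _ X
  Γ₀-lang X X∈ = (λ v p → inj₁ (proj₁ (ant-InLF w X∈) v p)) , proj₂ (ant-InLF w X∈)
  G-lang : InLanguage w _ (inst A (fvar a))
  G-lang = (λ v p → Data.Sum.map₁ (λ q → all A , inj₂ h , q) (fvF-inst-var A a p))
         , (λ c p → all A , inj₂ h , cF-inst-var A a p)
  -- Γ ⊢ A(a) with a fresh gives Γ ⊢ ∀x A(x) by ∀R, against consistency.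
  Γ₀-underivable : Underivable (ant w)
  Γ₀-underivable Γ Γ∈ d =
    consistent Γ (all A ∷ []) Γ∈ (h ∷ []) (∀R a (fresh-in-ant w a a∉ Γ Γ∈) (a∉ (all A) (inj₂ h)) d)

mainTheorem7 : ExcludedMiddle 0ℓ → (w : ISeq) → MaxConsistent w →
    ((A B : Fm) → suc' w (A ⇒ B) →
      ∃[ w' ] (MaxConsistent w' × w ≺ w' × ant w' A × suc' w' B))
    × ((A : Formula 1) → suc' w (all A) →
      ∃[ w' ] (MaxConsistent w' × w ≺ w' ×
        ∃[ a ] (suc' w' (inst A (fvar a)) × D w' (fvar a))))
mainTheorem7 em w (consistent , _) = part-i , part-ii
  where
  part-i : (A B : Fm) → suc' w (A ⇒ B) →
    ∃[ w' ] (MaxConsistent w' × w ≺ w' × ant w' A × suc' w' B)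
  part-i A B h = seq , maxCons , extends , contains-Γ₀ A (inj₂ refl) , contains-G
    where open Extension (implication-extension em w consistent A B h)

  part-ii : (A : Formula 1) → suc' w (all A) →
    ∃[ w' ] (MaxConsistent w' × w ≺ w' × ∃[ a ] (suc' w' (inst A (fvar a)) × D w' (fvar a)))
  part-ii A h with fresh w 0
  ... | a , _ , a∉ = seq , maxCons , extends , a , contains-G , a-defined
    where
    open Extension (universal-extension em w consistent A h a a∉)
    -- a occurs in w′ and a↓ = ⊤ holds in any maximal consistent sequent.
    a-defined : D seq (fvar a)
    a-defined = ((λ { v (here refl) → occurs-V a (inj₂ refl) }) , (λ _ ())) , maxConsistent-⊤ {seq} maxCons
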